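{- The term rewrite system $\mathcal{H}$ (over the unsorted signature described in the context, with $\mid$ an AC symbol) is AC terminating, i.e. the relation $\to_{\mathcal{H}/\mathrm{AC}}$ is well-founded on all terms (with variables, not necessarily well-sorted).
   Context: Terms are built from variables and the function symbols: constants $\mathsf{h},\mathsf{0}$; unary $\mathsf{I},\mathsf{E},\mathsf{s}$; binary $\mathsf{A},\mathsf{B},\mathsf{C},\mathsf{D}$ and the binary symbol $\mid$ written infix. The symbol $\mid$ is an AC symbol: $=_{\mathrm{AC}}$ is the congruence on terms generated by $(x\mid y)\mid z\approx x\mid(y\mid z)$ and $x\mid y\approx y\mid x$. For a set $\mathcal{R}$ of rewrite rules, $\to_{\mathcal{R}}$ is the closure of $\mathcal{R}$ under substitutions and contexts, and $\to_{\mathcal{R}/\mathrm{AC}}$ is the composition ${=_{\mathrm{AC}}}\cdot{\to_{\mathcal{R}}}\cdot{=_{\mathrm{AC}}}$; $\mathcal{R}$ is AC terminating if $\to_{\mathcal{R}/\mathrm{AC}}$ is well-founded. The TRS $\mathcal{H}$ consists of the 14 rules (with variables $n,x,y$): (1) $\mathsf{A}(n,\mathsf{I}(\mathsf{h}))\to\mathsf{A}(\mathsf{s}(n),\mathsf{h})$; (2) $\mathsf{A}(n,\mathsf{I}(\mathsf{h}\mid x))\to\mathsf{A}(\mathsf{s}(n),\mathsf{I}(x))$; (3) $\mathsf{A}(n,\mathsf{I}(x))\to\mathsf{B}(n,\mathsf{D}(\mathsf{s}(n),\mathsf{I}(x)))$; (4) $\mathsf{C}(\mathsf{0},x)\to\mathsf{E}(x)$;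 (5) $\mathsf{C}(\mathsf{s}(n),x)\to x\mid\mathsf{C}(n,x)$; (6) $\mathsf{I}(\mathsf{E}(x)\mid y)\to\mathsf{E}(\mathsf{I}(x\mid y))$; (7) $\mathsf{I}(\mathsf{E}(x))\to\mathsf{E}(\mathsf{I}(x))$; (8) $\mathsf{D}(n,\mathsf{I}(\mathsf{I}(x)))\to\mathsf{I}(\mathsf{D}(n,\mathsf{I}(x)))$; (9) $\mathsf{D}(n,\mathsf{I}(\mathsf{I}(x)\mid y))\to\mathsf{I}(\mathsf{D}(n,\mathsf{I}(x))\mid y)$; (10) $\mathsf{D}(n,\mathsf{I}(\mathsf{I}(\mathsf{h}\mid x)\mid y))\to\mathsf{I}(\mathsf{C}(n,\mathsf{I}(x))\mid y)$; (11) $\mathsf{D}(n,\mathsf{I}(\mathsf{I}(\mathsf{h}\mid x)))\to\mathsf{I}(\mathsf{C}(n,\mathsf{I}(x)))$; (12) $\mathsf{D}(n,\mathsf{I}(\mathsf{I}(\mathsf{h})\mid y))\to\mathsf{I}(\mathsf{C}(n,\mathsf{h})\mid y)$; (13) $\mathsf{D}(n,\mathsf{I}(\mathsf{I}(\mathsf{h})))\to\mathsf{I}(\mathsf{C}(n,\mathsf{h}))$; (14) $\mathsf{B}(n,\mathsf{E}(x))\to\mathsf{A}(\mathsf{s}(n),x)$. -}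

module Defs where

open import Data.Nat using (ℕ)
open import Data.Product using (∃-syntax; _×_)

Var : Set
Var = ℕ

infixr 5 _∣_
data Term : Set where
  var : Var → Term
  h 𝟘 : Term
  I E s : Term → Term
  A B C D : Term → Term → Term
  _∣_ : Term → Term → Term

Subst : Set
Subst = Var → Term

_[_] : Term → Subst → Term
var v [ σ ] = σ v
h [ σ ] = h
𝟘 [ σ ] = 𝟘
I t [ σ ] = I (t [ σ ])
E t [ σ ] = E (t [ σ ])
s t [ σ ] = s (t [ σ ])
A t u [ σ ] = A (t [ σ ]) (u [ σ ])
B t u [ σ ] = B (t [ σ ]) (u [ σ ])
C t u [ σ ] = C (t [ σ ]) (u [ σ ])
D t u [ σ ] = D (t [ σ ]) (u [ σ ])
(t ∣ u) [ σ ] = (t [ σ ]) ∣ (u [ σ ])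

infix 4 _≈AC_
data _≈AC_ : Term → Term → Set where
  ac-assoc : ∀ x y z → ((x ∣ y) ∣ z) ≈AC (x ∣ (y ∣ z))
  ac-comm  : ∀ x y → (x ∣ y) ≈AC (y ∣ x)
  ac-refl  : ∀ {t} → t ≈AC t
  ac-sym   : ∀ {t u} → t ≈AC u → u ≈AC t
  ac-trans : ∀ {t u v} → t ≈AC u → u ≈AC v → t ≈AC v
  ac-I : ∀ {t t'} → t ≈AC t' → I t ≈AC I t'
  ac-E : ∀ {t t'} → t ≈AC t' → E t ≈AC E t'
  ac-s : ∀ {t t'} → t ≈AC t' → s t ≈AC s t'
  ac-A : ∀ {t t' u u'} → t ≈AC t' → u ≈AC u' → A t u ≈AC A t' u'
  ac-B : ∀ {t t' u u'} → t ≈AC t' → u ≈AC u' → B t u ≈AC B t' u'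
  ac-C : ∀ {t t' u u'} → t ≈AC t' → u ≈AC u' → C t u ≈AC C t' u'
  ac-D : ∀ {t t' u u'} → t ≈AC t' → u ≈AC u' → D t u ≈AC D t' u'
  ac-∣ : ∀ {t t' u u'} → t ≈AC t' → u ≈AC u' → (t ∣ u) ≈AC (t' ∣ u')

n x y : Term
n = var 0
x = var 1
y = var 2

data H : Term → Term → Set where
  r1  : H (A n (I h)) (A (s n) h)
  r2  : H (A n (I (h ∣ x))) (A (s n) (I x))
  r3  : H (A n (I x)) (B n (D (s n) (I x)))
  r4  : H (C 𝟘 x) (E x)
  r5  : H (C (s n) x) (x ∣ C n x)
  r6  : H (I (E x ∣ y)) (E (I (x ∣ y)))
  r7  : H (I (E x)) (E (I x))
  r8  : H (D n (I (I x))) (I (D n (I x)))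
  r9  : H (D n (I (I x ∣ y))) (I (D n (I x) ∣ y))
  r10 : H (D n (I (I (h ∣ x) ∣ y))) (I (C n (I x) ∣ y))
  r11 : H (D n (I (I (h ∣ x)))) (I (C n (I x)))
  r12 : H (D n (I (I h ∣ y))) (I (C n h ∣ y))
  r13 : H (D n (I (I h))) (I (C n h))
  r14 : H (B n (E x)) (A (s n) x)

infix 4 _⊢_⟶_
data _⊢_⟶_ (R : Term → Term → Set) : Term → Term → Set where
  root : ∀ {l r} → R l r → (σ : Subst) → R ⊢ l [ σ ] ⟶ r [ σ ]
  ctx-I : ∀ {t t'} → R ⊢ t ⟶ t' → R ⊢ I t ⟶ I t'
  ctx-E : ∀ {t t'} → R ⊢ t ⟶ t' → R ⊢ E t ⟶ E t'
  ctx-s : ∀ {t t'} → R ⊢ t ⟶ t' → R ⊢ s t ⟶ s t'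
  ctx-A₁ : ∀ {t t' u} → R ⊢ t ⟶ t' → R ⊢ A t u ⟶ A t' u
  ctx-A₂ : ∀ {t u u'} → R ⊢ u ⟶ u' → R ⊢ A t u ⟶ A t u'
  ctx-B₁ : ∀ {t t' u} → R ⊢ t ⟶ t' → R ⊢ B t u ⟶ B t' u
  ctx-B₂ : ∀ {t u u'} → R ⊢ u ⟶ u' → R ⊢ B t u ⟶ B t u'
  ctx-C₁ : ∀ {t t' u} → R ⊢ t ⟶ t' → R ⊢ C t u ⟶ C t' u
  ctx-C₂ : ∀ {t u u'} → R ⊢ u ⟶ u' → R ⊢ C t u ⟶ C t u'
  ctx-D₁ : ∀ {t t' u} → R ⊢ t ⟶ t' → R ⊢ D t u ⟶ D t' u
  ctx-D₂ : ∀ {t u u'} → R ⊢ u ⟶ u' → R ⊢ D t u ⟶ D t u'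
  ctx-∣₁ : ∀ {t t' u} → R ⊢ t ⟶ t' → R ⊢ (t ∣ u) ⟶ (t' ∣ u)
  ctx-∣₂ : ∀ {t u u'} → R ⊢ u ⟶ u' → R ⊢ (t ∣ u) ⟶ (t ∣ u')

infix 4 _⊢_⟶AC_
_⊢_⟶AC_ : (Term → Term → Set) → Term → Term → Set
R ⊢ t ⟶AC u = ∃[ t' ] ∃[ u' ] (t ≈AC t' × R ⊢ t' ⟶ u' × u' ≈AC u)

-- Converse of the step relation: u is "smaller" than t when t ⟶ u.
-- Well-foundedness of this (every term accessible) = no infinite
-- →_{R/AC} sequence.
_⟵AC_ : Term → Term → Set
u ⟵AC t = H ⊢ t ⟶AC u

{-# OPTIONS --safe #-}
-- The proof combines three measures lexicographically, inside an induction on the nesting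
-- depth of counters (the first arguments of A, B, C, D).
--
-- ⟦_⟧ interprets terms as ordinals below ε₀ in Cantor normal form: ∣ becomes the natural
-- (Hessenberg) sum, which is commutative and associative, hence invariant under =AC, and I
-- becomes α ↦ ω^α. Counters are ignored, except that C reads the numeral s(⋯s(0)) in its first
-- argument. Every rule except 8 and 9 strictly decreases ⟦_⟧; since rule 5 duplicates x,
-- C(n, x) counts ⟦x⟧ with multiplicity n + 1.
--
-- A step inside a counter leaves ⟦_⟧ unchanged and is a step of the collection of counters,
-- which is accessible by the outer induction since its counters are nested less deeply.
-- Rules 8 and 9 push a D inwards; they keep ⟦_⟧ and the counters and shrink the total size of
-- the second arguments of D. At depth 0 the counters consist of h and ∣ only, which are normal.

module Submission where

open import Data.Empty using (⊥-elim)
open import Data.Nat as ℕ using (ℕ; zero; suc; _+_; _⊔_; z≤n; s≤s)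
import Data.Nat.Properties as ℕ
open import Data.Nat.Induction using (<-wellFounded)
open import Data.Nat.Tactic.RingSolver using (solve-∀)
open import Data.Product using (_×_; _,_; proj₁; proj₂)
open import Data.Product.Relation.Binary.Lex.Strict using (×-Lex; ×-wellFounded; ×-wellFounded')
open import Data.Sum using (_⊎_; inj₁; inj₂)
open import Data.Unit using (⊤; tt)
open import Induction.WellFounded using (WellFounded; Acc; acc; Acc-resp-≈; module Subrelation)
open import Relation.Binary.Construct.On as On using ()
open import Relation.Binary.Definitions using (Tri; tri<; tri≈; tri>; Trichotomous; _Respectsʳ_)
open import Relation.Binary.PropositionalEquality hiding ([_])
open import Relation.Nullary using (¬_)

module Ordinal where

  infixr 6 ω^_+_
  data Ord : Set where
    𝟎 : Ord
    ω^_+_ : Ord → Ord → Ord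

  variable
    a b c d f : Ord
    α β γ : Ord

  infix 4 _<_ _≤_
  data _<_ : Ord → Ord → Set where
    𝟎<ω^   : 𝟎 < ω^ a + b
    <-exp  : a < c → ω^ a + b < ω^ c + d
    <-tail : b < d → ω^ a + b < ω^ a + d

  _≤_ : Ord → Ord → Set
  α ≤ β = α < β ⊎ α ≡ β

  <-trans : α < β → β < γ → α < γ
  <-trans 𝟎<ω^       (<-exp _)  = 𝟎<ω^
  <-trans 𝟎<ω^       (<-tail _) = 𝟎<ω^
  <-trans (<-exp p)  (<-exp q)  = <-exp (<-trans p q)
  <-trans (<-exp p)  (<-tail _) = <-exp p
  <-trans (<-tail _) (<-exp q)  = <-exp q
  <-trans (<-tail p) (<-tail q) = <-tail (<-trans p q)

  <-irrefl : ¬ α < α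
  <-irrefl (<-exp p)  = <-irrefl p
  <-irrefl (<-tail p) = <-irrefl p

  <-asym : α < β → ¬ β < α
  <-asym p q = <-irrefl (<-trans p q)

  ≤-trans : α ≤ β → β ≤ γ → α ≤ γ
  ≤-trans (inj₁ p)    (inj₁ q)    = inj₁ (<-trans p q)
  ≤-trans (inj₁ p)    (inj₂ refl) = inj₁ p
  ≤-trans (inj₂ refl) q           = q

  <⇒𝟎< : α < β → 𝟎 < β
  <⇒𝟎< 𝟎<ω^       = 𝟎<ω^
  <⇒𝟎< (<-exp _)  = 𝟎<ω^
  <⇒𝟎< (<-tail _) = 𝟎<ω^

  tri-< : α < β → Tri (α < β) (α ≡ β) (β < α)
  tri-< p = tri< p (λ { refl → <-irrefl p }) (<-asym p)

  tri-> : β < α → Tri (α < β) (α ≡ β) (β < α)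
  tri-> p = tri> (<-asym p) (λ { refl → <-irrefl p }) p

  <-cmp : Trichotomous _≡_ _<_
  <-cmp 𝟎          𝟎          = tri≈ <-irrefl refl <-irrefl
  <-cmp 𝟎          (ω^ _ + _) = tri< 𝟎<ω^ (λ ()) (λ ())
  <-cmp (ω^ _ + _) 𝟎          = tri> (λ ()) (λ ()) 𝟎<ω^
  <-cmp (ω^ a + b) (ω^ c + d) with <-cmp a c
  ... | tri< p _ _ = tri-< (<-exp p)
  ... | tri> _ _ p = tri-> (<-exp p)
  ... | tri≈ _ refl _ with <-cmp b d
  ...   | tri< q _ _    = tri-< (<-tail q)
  ...   | tri≈ _ refl _ = tri≈ <-irrefl refl <-irrefl
  ...   | tri> _ _ q    = tri-> (<-tail q)

  infixl 7 _⊕_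
  mutual
    _⊕_ : Ord → Ord → Ord
    𝟎          ⊕ β = β
    (ω^ a + b) ⊕ β = ω^[ a + b ]⊕ β

    ω^[_+_]⊕_ : Ord → Ord → Ord → Ord
    ω^[ a + b ]⊕ 𝟎          = ω^ a + b
    ω^[ a + b ]⊕ (ω^ c + d) = merge a b c d (<-cmp a c)

    merge : (a b c d : Ord) → Tri (a < c) (a ≡ c) (c < a) → Ord
    merge a b c d (tri< _ _ _) = ω^ c + ω^[ a + b ]⊕ d
    merge a b c d (tri≈ _ _ _) = ω^ a + ω^ c + (b ⊕ d)
    merge a b c d (tri> _ _ _) = ω^ a + (b ⊕ (ω^ c + d))

  ⊕-identityʳ : ∀ α → α ⊕ 𝟎 ≡ α
  ⊕-identityʳ 𝟎          = refl
  ⊕-identityʳ (ω^ _ + _) = refl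

  -- For β in normal form: every exponent of β is at most a.
  infix 4 _≤ₑ_
  _≤ₑ_ : Ord → Ord → Set
  𝟎          ≤ₑ a = ⊤
  (ω^ c + _) ≤ₑ a = c ≤ a

  NF : Ord → Set
  NF 𝟎          = ⊤
  NF (ω^ a + b) = NF a × NF b × b ≤ₑ a

  ⊕-≤ₑ : ∀ α β → α ≤ₑ c → β ≤ₑ c → α ⊕ β ≤ₑ c
  ⊕-≤ₑ 𝟎          _          _ q = q
  ⊕-≤ₑ (ω^ _ + _) 𝟎          p _ = p
  ⊕-≤ₑ (ω^ a + b) (ω^ c + d) p q with <-cmp a c
  ... | tri< _ _ _ = q
  ... | tri≈ _ _ _ = p
  ... | tri> _ _ _ = p

  mutual
    ⊕-NF : ∀ α β → NF α → NF β → NF (α ⊕ β)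
    ⊕-NF 𝟎          β p q = q
    ⊕-NF (ω^ a + b) β p q = ω^⊕-NF a b β p q

    ω^⊕-NF : ∀ a b β → NF (ω^ a + b) → NF β → NF (ω^[ a + b ]⊕ β)
    ω^⊕-NF a b 𝟎          p q = p
    ω^⊕-NF a b (ω^ c + d) p q = merge-NF a b c d (<-cmp a c) p q

    merge-NF : ∀ a b c d t → NF (ω^ a + b) → NF (ω^ c + d) → NF (merge a b c d t)
    merge-NF a b c d (tri< a<c _ _) p@(na , nb , b≤a) (nc , nd , d≤c) =
      nc , ω^⊕-NF a b d p nd , ⊕-≤ₑ (ω^ a + b) d (inj₁ a<c) d≤c
    merge-NF a b c d (tri≈ _ refl _) (na , nb , b≤a) (nc , nd , d≤c) =
      na , (nc , ⊕-NF b d nb nd , ⊕-≤ₑ b d b≤a d≤c) , inj₂ refl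
    merge-NF a b c d (tri> _ _ c<a) (na , nb , b≤a) q =
      na , ⊕-NF b (ω^ c + d) nb q , ⊕-≤ₑ b (ω^ c + d) b≤a (inj₁ c<a)

  δ : Ord → Ord → ℕ
  δ x a with <-cmp x a
  ... | tri< _ _ _ = 0
  ... | tri≈ _ _ _ = 1
  ... | tri> _ _ _ = 0

  δ-refl : ∀ a → δ a a ≡ 1
  δ-refl a with <-cmp a a
  ... | tri< p _ _ = ⊥-elim (<-irrefl p)
  ... | tri≈ _ _ _ = refl
  ... | tri> _ _ p = ⊥-elim (<-irrefl p)

  mult : Ord → Ord → ℕ
  mult x 𝟎          = 0
  mult x (ω^ a + b) = δ x a + mult x b

  mutual
    mult-⊕ : ∀ x α β → mult x (α ⊕ β) ≡ mult x α + mult x β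
    mult-⊕ x 𝟎          β = refl
    mult-⊕ x (ω^ a + b) β = mult-ω^⊕ x a b β

    mult-ω^⊕ : ∀ x a b β → mult x (ω^[ a + b ]⊕ β) ≡ mult x (ω^ a + b) + mult x β
    mult-ω^⊕ x a b 𝟎          = sym (ℕ.+-identityʳ _)
    mult-ω^⊕ x a b (ω^ c + d) = mult-merge x a b c d (<-cmp a c)

    mult-merge : ∀ x a b c d t → mult x (merge a b c d t) ≡ mult x (ω^ a + b) + mult x (ω^ c + d)
    mult-merge x a b c d (tri< _ _ _) =
      trans (cong (δ x c +_) (mult-ω^⊕ x a b d)) (shuffle (δ x a) (mult x b) (mult x d) (δ x c))
      where
      shuffle : ∀ p q r s → s + (p + q + r) ≡ p + q + (s + r)
      shuffle = solve-∀
    mult-merge x a b c d (tri≈ _ _ _) =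
      trans (cong (λ m → δ x a + (δ x c + m)) (mult-⊕ x b d)) (shuffle (δ x a) (mult x b) (mult x d) (δ x c))
      where
      shuffle : ∀ p q r s → p + (s + (q + r)) ≡ p + q + (s + r)
      shuffle = solve-∀
    mult-merge x a b c d (tri> _ _ _) =
      trans (cong (δ x a +_) (mult-⊕ x b (ω^ c + d))) (sym (ℕ.+-assoc (δ x a) _ _))

  mult>0⇒≤ : ∀ x β → NF β → β ≤ₑ c → 0 ℕ.< mult x β → x ≤ c
  mult>0⇒≤ x (ω^ e + f) (_ , nf , f≤e) e≤c pos with <-cmp x e
  ... | tri< _ _ _    = ≤-trans (mult>0⇒≤ x f nf f≤e pos) e≤c
  ... | tri≈ _ refl _ = e≤c
  ... | tri> _ _ _    = ≤-trans (mult>0⇒≤ x f nf f≤e pos) e≤c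

  mult-head>0 : ∀ a b → 0 ℕ.< mult a (ω^ a + b)
  mult-head>0 a b rewrite δ-refl a = s≤s z≤n

  ≡-exp-by-mult : NF (ω^ a + b) → NF (ω^ c + d) →
                  (∀ x → mult x (ω^ a + b) ≡ mult x (ω^ c + d)) → a ≡ c
  ≡-exp-by-mult {a} {b} {c} {d} p q m
    with mult>0⇒≤ a (ω^ c + d) q (inj₂ refl) (ℕ.≤-trans (mult-head>0 a b) (ℕ.≤-reflexive (m a)))
       | mult>0⇒≤ c (ω^ a + b) p (inj₂ refl) (ℕ.≤-trans (mult-head>0 c d) (ℕ.≤-reflexive (sym (m c))))
  ... | inj₂ a≡c | _        = a≡c
  ... | inj₁ _   | inj₂ c≡a = sym c≡a
  ... | inj₁ a<c | inj₁ c<a = ⊥-elim (<-asym a<c c<a)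

  ≡-by-mult : ∀ α β → NF α → NF β → (∀ x → mult x α ≡ mult x β) → α ≡ β
  ≡-by-mult 𝟎          𝟎          _ _ _ = refl
  ≡-by-mult 𝟎          (ω^ c + d) _ _ m with trans (m c) (cong (_+ mult c d) (δ-refl c))
  ... | ()
  ≡-by-mult (ω^ a + b) 𝟎          _ _ m with trans (sym (m a)) (cong (_+ mult a b) (δ-refl a))
  ... | ()
  ≡-by-mult (ω^ a + b) (ω^ c + d) p q m with ≡-exp-by-mult p q m
  ... | refl = cong (ω^ a +_) (≡-by-mult b d (proj₁ (proj₂ p)) (proj₁ (proj₂ q))
                                 (λ x → ℕ.+-cancelˡ-≡ (δ x a) _ _ (m x)))

  ⊕-comm : ∀ α β → NF α → NF β → α ⊕ β ≡ β ⊕ α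
  ⊕-comm α β p q = ≡-by-mult _ _ (⊕-NF α β p q) (⊕-NF β α q p) λ x → begin
    mult x (α ⊕ β)          ≡⟨ mult-⊕ x α β ⟩
    mult x α + mult x β     ≡⟨ ℕ.+-comm (mult x α) _ ⟩
    mult x β + mult x α     ≡⟨ mult-⊕ x β α ⟨
    mult x (β ⊕ α)          ∎
    where open ≡-Reasoning

  ⊕-assoc : ∀ α β γ → NF α → NF β → NF γ → α ⊕ β ⊕ γ ≡ α ⊕ (β ⊕ γ)
  ⊕-assoc α β γ p q r =
    ≡-by-mult _ _ (⊕-NF (α ⊕ β) γ (⊕-NF α β p q) r) (⊕-NF α (β ⊕ γ) p (⊕-NF β γ q r)) λ x → begin
    mult x (α ⊕ β ⊕ γ)                   ≡⟨ mult-⊕ x (α ⊕ β) γ ⟩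
    mult x (α ⊕ β) + mult x γ            ≡⟨ cong (_+ mult x γ) (mult-⊕ x α β) ⟩
    mult x α + mult x β + mult x γ       ≡⟨ ℕ.+-assoc (mult x α) _ _ ⟩
    mult x α + (mult x β + mult x γ)     ≡⟨ cong (mult x α +_) (mult-⊕ x β γ) ⟨
    mult x α + mult x (β ⊕ γ)            ≡⟨ mult-⊕ x α (β ⊕ γ) ⟨
    mult x (α ⊕ (β ⊕ γ))                 ∎
    where open ≡-Reasoning

  ω^⟨_⟩ : Ord → Ord
  ω^⟨ a ⟩ = ω^ a + 𝟎

  𝟏 : Ord
  𝟏 = ω^⟨ 𝟎 ⟩

  ω^⟨⟩-NF : NF a → NF ω^⟨ a ⟩
  ω^⟨⟩-NF p = p , tt , tt

  𝟏-NF : NF 𝟏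
  𝟏-NF = ω^⟨⟩-NF tt

  ω^+≡ω^⟨⟩⊕ : ∀ a b → b ≤ₑ a → ω^ a + b ≡ ω^⟨ a ⟩ ⊕ b
  ω^+≡ω^⟨⟩⊕ a 𝟎          _ = refl
  ω^+≡ω^⟨⟩⊕ a (ω^ c + d) c≤a with <-cmp a c | c≤a
  ... | tri< a<c _ _ | inj₁ c<a  = ⊥-elim (<-asym a<c c<a)
  ... | tri< a<c _ _ | inj₂ refl = ⊥-elim (<-irrefl a<c)
  ... | tri≈ _ refl _ | _        = refl
  ... | tri> _ _ _ | _           = refl

  ω^⟨⟩⊕-monoʳ-< : ∀ a {β γ} → β < γ → ω^⟨ a ⟩ ⊕ β < ω^⟨ a ⟩ ⊕ γ
  ω^⟨⟩⊕-monoʳ-< a {𝟎} {ω^ e + _} 𝟎<ω^ with <-cmp a e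
  ... | tri< a<e _ _  = <-exp a<e
  ... | tri≈ _ refl _ = <-tail 𝟎<ω^
  ... | tri> _ _ _    = <-tail 𝟎<ω^
  ω^⟨⟩⊕-monoʳ-< a {ω^ c + _} {ω^ e + _} (<-exp c<e) with <-cmp a c | <-cmp a e
  ... | tri< _ _ _    | tri< _ _ _    = <-exp c<e
  ... | tri< a<c _ _  | tri≈ _ refl _ = ⊥-elim (<-asym a<c c<e)
  ... | tri< a<c _ _  | tri> _ _ e<a  = ⊥-elim (<-asym (<-trans a<c c<e) e<a)
  ... | tri≈ _ refl _ | tri< a<e _ _  = <-exp a<e
  ... | tri≈ _ refl _ | tri≈ _ refl _ = ⊥-elim (<-irrefl c<e)
  ... | tri≈ _ refl _ | tri> _ _ e<a  = ⊥-elim (<-asym c<e e<a)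
  ... | tri> _ _ _    | tri< a<e _ _  = <-exp a<e
  ... | tri> _ _ _    | tri≈ _ refl _ = <-tail (<-exp c<e)
  ... | tri> _ _ _    | tri> _ _ _    = <-tail (<-exp c<e)
  ω^⟨⟩⊕-monoʳ-< a {ω^ c + _} {ω^ .c + _} (<-tail d<f) with <-cmp a c
  ... | tri< _ _ _    = <-tail (ω^⟨⟩⊕-monoʳ-< a d<f)
  ... | tri≈ _ refl _ = <-tail (<-tail d<f)
  ... | tri> _ _ _    = <-tail (<-tail d<f)

  ⊕-monoʳ-< : ∀ α → NF α → NF β → NF γ → β < γ → α ⊕ β < α ⊕ γ
  ⊕-monoʳ-< 𝟎          _                 _  _  β<γ = β<γ
  ⊕-monoʳ-< (ω^ a + b) (na , nb , b≤a) nβ nγ β<γ =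
    subst₂ _<_ (sym (split nβ)) (sym (split nγ)) (ω^⟨⟩⊕-monoʳ-< a (⊕-monoʳ-< b nb nβ nγ β<γ))
    where
    split : NF β → (ω^ a + b) ⊕ β ≡ ω^⟨ a ⟩ ⊕ (b ⊕ β)
    split {β} nβ = trans (cong (_⊕ β) (ω^+≡ω^⟨⟩⊕ a b b≤a)) (⊕-assoc ω^⟨ a ⟩ b β (ω^⟨⟩-NF na) nb nβ)

  ⊕-monoˡ-< : ∀ α → NF α → NF β → NF γ → β < γ → β ⊕ α < γ ⊕ α
  ⊕-monoˡ-< {β} {γ} α nα nβ nγ β<γ
    rewrite ⊕-comm β α nβ nα | ⊕-comm γ α nγ nα = ⊕-monoʳ-< α nα nβ nγ β<γ

  ⊕-mono-< : ∀ {α α' β β'} → NF α → NF α' → NF β → NF β' → α < α' → β < β' → α ⊕ β < α' ⊕ β'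
  ⊕-mono-< {α} {α'} {β} {β'} nα nα' nβ nβ' α<α' β<β' =
    <-trans (⊕-monoʳ-< α nα nβ nβ' β<β') (⊕-monoˡ-< β' nβ' nα nα' α<α')

  <⊕𝟏 : ∀ α → NF α → α < α ⊕ 𝟏
  <⊕𝟏 α nα = subst (_< α ⊕ 𝟏) (⊕-identityʳ α) (⊕-monoʳ-< α nα tt 𝟏-NF 𝟎<ω^)

  ⊕-<ω^⟨⟩ : ∀ α β → α < ω^⟨ c ⟩ → β < ω^⟨ c ⟩ → α ⊕ β < ω^⟨ c ⟩
  ⊕-<ω^⟨⟩ 𝟎          _          _         q         = q
  ⊕-<ω^⟨⟩ (ω^ _ + _) 𝟎          p         _         = p
  ⊕-<ω^⟨⟩ (ω^ a + b) (ω^ e + f) (<-exp p) (<-exp q) with <-cmp a e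
  ... | tri< _ _ _ = <-exp q
  ... | tri≈ _ _ _ = <-exp p
  ... | tri> _ _ _ = <-exp p

  <𝟏⊕ : ∀ α → NF α → α < 𝟏 ⊕ α
  <𝟏⊕ α nα = subst (α <_) (⊕-comm α 𝟏 nα 𝟏-NF) (<⊕𝟏 α nα)

  ω^⟨⟩⊕𝟏-< : α < β → ω^⟨ α ⟩ ⊕ 𝟏 < ω^⟨ β ⟩
  ω^⟨⟩⊕𝟏-< α<β = ⊕-<ω^⟨⟩ _ _ (<-exp α<β) (<-exp (<⇒𝟎< α<β))

  infixr 8 _·_
  _·_ : ℕ → Ord → Ord
  zero        · α = 𝟎
  suc zero    · α = α
  suc (suc k) · α = α ⊕ suc k · α

  ·-NF : ∀ k → NF α → NF (k · α)
  ·-NF zero          _  = tt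
  ·-NF (suc zero)    nα = nα
  ·-NF (suc (suc k)) nα = ⊕-NF _ _ nα (·-NF (suc k) nα)

  ·-monoʳ-< : ∀ k → NF α → NF β → α < β → suc k · α < suc k · β
  ·-monoʳ-< zero    _  _  α<β = α<β
  ·-monoʳ-< (suc k) nα nβ α<β =
    ⊕-mono-< nα nβ (·-NF (suc k) nα) (·-NF (suc k) nβ) α<β (·-monoʳ-< k nα nβ α<β)

  ·-<ω^⟨⟩ : ∀ k → α < ω^⟨ c ⟩ → k · α < ω^⟨ c ⟩
  ·-<ω^⟨⟩ zero          _ = 𝟎<ω^
  ·-<ω^⟨⟩ (suc zero)    p = p
  ·-<ω^⟨⟩ (suc (suc k)) p = ⊕-<ω^⟨⟩ _ _ p (·-<ω^⟨⟩ (suc k) p)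

  infix 4 _≺_
  _≺_ : Ord → Ord → Set
  β ≺ α = NF β × β < α

  𝟎-acc : Acc _≺_ 𝟎
  𝟎-acc = acc λ ()

  mutual
    ≤ₑ-acc : ∀ a → Acc _≺_ a → ∀ α → NF α → α ≤ₑ a → Acc _≺_ α
    ≤ₑ-acc a _        𝟎          _              _           = 𝟎-acc
    ≤ₑ-acc a (acc rs) (ω^ c + e) nα             (inj₁ c<a)  =
      ≤ₑ-acc c (rs (proj₁ nα , c<a)) _ nα (inj₂ refl)
    ≤ₑ-acc a accA     (ω^ .a + e) (_ , ne , e≤a) (inj₂ refl) = ω^+-acc a accA e (≤ₑ-acc a accA e ne e≤a)

    ω^+-acc : ∀ a → Acc _≺_ a → ∀ e → Acc _≺_ e → Acc _≺_ (ω^ a + e)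
    ω^+-acc a accA e (acc rsE) = acc λ where
      (_ , 𝟎<ω^)                 → 𝟎-acc
      (nβ , <-exp c<a)            → exp<-acc a accA nβ c<a
      ((_ , nf , _) , <-tail f<e) → ω^+-acc a accA _ (rsE (nf , f<e))

    exp<-acc : ∀ a → Acc _≺_ a → NF (ω^ c + f) → c < a → Acc _≺_ (ω^ c + f)
    exp<-acc a (acc rs) nβ@(nc , _) c<a = ≤ₑ-acc _ (rs (nc , c<a)) _ nβ (inj₂ refl)

  NF⇒acc : ∀ α → NF α → Acc _≺_ α
  NF⇒acc 𝟎          _            = 𝟎-acc
  NF⇒acc (ω^ a + _) nα@(na , _) = ≤ₑ-acc a (NF⇒acc a na) _ nα (inj₂ refl)

  ≺-wellFounded : WellFounded _≺_
  ≺-wellFounded α = acc λ (nβ , _) → NF⇒acc _ nβ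

module Restriction where

  _restrictedTo_ : {A : Set} → (A → A → Set) → (A → Set) → A → A → Set
  (_<_ restrictedTo P) y x = P x × y < x

  module _ {A : Set} {_<_ : A → A → Set} where

    acc⇒acc-restrictedTo-Acc : ∀ {x} → Acc _<_ x → Acc (_<_ restrictedTo Acc _<_) x
    acc⇒acc-restrictedTo-Acc (acc rs) = acc λ (_ , y<x) → acc⇒acc-restrictedTo-Acc (rs y<x)

    restrictedTo-Acc-wellFounded : WellFounded (_<_ restrictedTo Acc _<_)
    restrictedTo-Acc-wellFounded x = acc λ { (acc rs , y<x) → acc⇒acc-restrictedTo-Acc (rs y<x) }

    acc-restrictedTo⇒acc : ∀ {P} → (∀ {x y} → P x → y < x → P y) →
                           ∀ {x} → P x → Acc (_<_ restrictedTo P) x → Acc _<_ x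
    acc-restrictedTo⇒acc closed px (acc rs) =
      acc λ y<x → acc-restrictedTo⇒acc closed (closed px y<x) (rs (px , y<x))

open import Defs
open Ordinal
open Restriction

variable
  t t' u u' : Term

numeral : Term → ℕ
numeral (s t) = suc (numeral t)
numeral _     = 0

⟦A⟧ : Ord → Ord
⟦A⟧ α = 2 · α ⊕ 𝟏

⟦C⟧ : ℕ → Ord → Ord
⟦C⟧ k α = suc k · α ⊕ suc (suc k) · 𝟏

⟦_⟧ : Term → Ord
⟦ var _ ⟧ = 𝟎
⟦ h ⟧     = 𝟏
⟦ 𝟘 ⟧     = 𝟎
⟦ I t ⟧   = ω^⟨ ⟦ t ⟧ ⟩
⟦ E t ⟧   = ⟦ t ⟧ ⊕ 𝟏
⟦ s t ⟧   = ⟦ t ⟧ ⊕ 𝟏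
⟦ A m t ⟧ = ⟦A⟧ ⟦ t ⟧
⟦ B m t ⟧ = 2 · ⟦ t ⟧
⟦ C m t ⟧ = ⟦C⟧ (numeral m) ⟦ t ⟧
⟦ D m t ⟧ = ⟦ t ⟧
⟦ t ∣ u ⟧ = ⟦ t ⟧ ⊕ ⟦ u ⟧

⟦A⟧-NF : NF α → NF (⟦A⟧ α)
⟦A⟧-NF nα = ⊕-NF _ _ (·-NF 2 nα) 𝟏-NF

⟦A⟧-monoʳ-< : NF α → NF β → α < β → ⟦A⟧ α < ⟦A⟧ β
⟦A⟧-monoʳ-< nα nβ α<β = ⊕-monoˡ-< 𝟏 𝟏-NF (·-NF 2 nα) (·-NF 2 nβ) (·-monoʳ-< 1 nα nβ α<β)

⟦A⟧<2·[⊕𝟏] : ∀ α → NF α → ⟦A⟧ α < 2 · (α ⊕ 𝟏)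
⟦A⟧<2·[⊕𝟏] α nα = subst (_< 2 · (α ⊕ 𝟏)) (sym (⊕-assoc α α 𝟏 nα nα 𝟏-NF))
  (⊕-monoˡ-< (α ⊕ 𝟏) (⊕-NF α 𝟏 nα 𝟏-NF) nα (⊕-NF α 𝟏 nα 𝟏-NF) (<⊕𝟏 α nα))

⟦C⟧-NF : ∀ k {α} → NF α → NF (⟦C⟧ k α)
⟦C⟧-NF k nα = ⊕-NF _ _ (·-NF (suc k) nα) (·-NF (suc (suc k)) 𝟏-NF)

⟦C⟧-monoʳ-< : ∀ k → NF α → NF β → α < β → ⟦C⟧ k α < ⟦C⟧ k β
⟦C⟧-monoʳ-< k nα nβ α<β =
  ⊕-monoˡ-< _ (·-NF (suc (suc k)) 𝟏-NF) (·-NF (suc k) nα) (·-NF (suc k) nβ) (·-monoʳ-< k nα nβ α<β)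

⟦C⟧-<ω^⟨⟩ : ∀ k → α < ω^⟨ c ⟩ → 𝟎 < c → ⟦C⟧ k α < ω^⟨ c ⟩
⟦C⟧-<ω^⟨⟩ k α<ω^c 𝟎<c = ⊕-<ω^⟨⟩ _ _ (·-<ω^⟨⟩ (suc k) α<ω^c) (·-<ω^⟨⟩ (suc (suc k)) (<-exp 𝟎<c))

-- (k + 2)·α ⊕ (k + 3) exceeds α ⊕ ((k + 1)·α ⊕ (k + 2)) by exactly 1.
⊕⟦C⟧<⟦C⟧-suc : ∀ k → NF α → α ⊕ ⟦C⟧ k α < ⟦C⟧ (suc k) α
⊕⟦C⟧<⟦C⟧-suc {α} k nα = subst (α ⊕ (P ⊕ Q) <_) (sym (⊕-assoc α P (𝟏 ⊕ Q) nα nP n𝟏Q))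
  (⊕-monoʳ-< α nα (⊕-NF P Q nP nQ) (⊕-NF P (𝟏 ⊕ Q) nP n𝟏Q) (⊕-monoʳ-< P nP nQ n𝟏Q (<𝟏⊕ Q nQ)))
  where
  P = suc k · α
  Q = suc (suc k) · 𝟏
  nP = ·-NF (suc k) nα
  nQ = ·-NF (suc (suc k)) 𝟏-NF
  n𝟏Q = ⊕-NF 𝟏 Q 𝟏-NF nQ

⟦⟧-NF : ∀ t → NF ⟦ t ⟧
⟦⟧-NF (var _) = tt
⟦⟧-NF h       = 𝟏-NF
⟦⟧-NF 𝟘       = tt
⟦⟧-NF (I t)   = ω^⟨⟩-NF (⟦⟧-NF t)
⟦⟧-NF (E t)   = ⊕-NF _ _ (⟦⟧-NF t) 𝟏-NF
⟦⟧-NF (s t)   = ⊕-NF _ _ (⟦⟧-NF t) 𝟏-NF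
⟦⟧-NF (A m t) = ⟦A⟧-NF (⟦⟧-NF t)
⟦⟧-NF (B m t) = ·-NF 2 (⟦⟧-NF t)
⟦⟧-NF (C m t) = ⟦C⟧-NF (numeral m) (⟦⟧-NF t)
⟦⟧-NF (D m t) = ⟦⟧-NF t
⟦⟧-NF (t ∣ u) = ⊕-NF _ _ (⟦⟧-NF t) (⟦⟧-NF u)

size : Term → ℕ
size (var _) = 1
size h       = 1
size 𝟘       = 1
size (I t)   = suc (size t)
size (E t)   = suc (size t)
size (s t)   = suc (size t)
size (A m t) = suc (size m + size t)
size (B m t) = suc (size m + size t)
size (C m t) = suc (size m + size t)
size (D m t) = suc (size m + size t)
size (t ∣ u) = suc (size t + size u)

dArgSize : Term → ℕ
dArgSize (var _) = 0
dArgSize h       = 0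
dArgSize 𝟘       = 0
dArgSize (I t)   = dArgSize t
dArgSize (E t)   = dArgSize t
dArgSize (s t)   = dArgSize t
dArgSize (A m t) = dArgSize t
dArgSize (B m t) = dArgSize t
dArgSize (C m t) = dArgSize t
dArgSize (D m t) = size t + dArgSize t
dArgSize (t ∣ u) = dArgSize t + dArgSize u

-- The outermost counters, collected with ∣; h stands for the empty collection.
counters : Term → Term
counters (var _) = h
counters h       = h
counters 𝟘       = h
counters (I t)   = counters t
counters (E t)   = counters t
counters (s t)   = counters t
counters (A m t) = m ∣ counters t
counters (B m t) = m ∣ counters t
counters (C m t) = m ∣ counters t
counters (D m t) = m ∣ counters t
counters (t ∣ u) = counters t ∣ counters u

counterDepth : Term → ℕ
counterDepth (var _) = 0
counterDepth h       = 0
counterDepth 𝟘       = 0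
counterDepth (I t)   = counterDepth t
counterDepth (E t)   = counterDepth t
counterDepth (s t)   = counterDepth t
counterDepth (A m t) = suc (counterDepth m) ⊔ counterDepth t
counterDepth (B m t) = suc (counterDepth m) ⊔ counterDepth t
counterDepth (C m t) = suc (counterDepth m) ⊔ counterDepth t
counterDepth (D m t) = suc (counterDepth m) ⊔ counterDepth t
counterDepth (t ∣ u) = counterDepth t ⊔ counterDepth u

numeral-ac : t ≈AC u → numeral t ≡ numeral u
numeral-ac (ac-assoc _ _ _) = refl
numeral-ac (ac-comm _ _)    = refl
numeral-ac ac-refl          = refl
numeral-ac (ac-sym p)       = sym (numeral-ac p)
numeral-ac (ac-trans p q)   = trans (numeral-ac p) (numeral-ac q)
numeral-ac (ac-I _)         = refl
numeral-ac (ac-E _)         = refl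
numeral-ac (ac-s p)         = cong suc (numeral-ac p)
numeral-ac (ac-A _ _)       = refl
numeral-ac (ac-B _ _)       = refl
numeral-ac (ac-C _ _)       = refl
numeral-ac (ac-D _ _)       = refl
numeral-ac (ac-∣ _ _)       = refl

⟦⟧-ac : t ≈AC u → ⟦ t ⟧ ≡ ⟦ u ⟧
⟦⟧-ac (ac-assoc t u v) = ⊕-assoc ⟦ t ⟧ ⟦ u ⟧ ⟦ v ⟧ (⟦⟧-NF t) (⟦⟧-NF u) (⟦⟧-NF v)
⟦⟧-ac (ac-comm t u)    = ⊕-comm ⟦ t ⟧ ⟦ u ⟧ (⟦⟧-NF t) (⟦⟧-NF u)
⟦⟧-ac ac-refl          = refl
⟦⟧-ac (ac-sym p)       = sym (⟦⟧-ac p)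
⟦⟧-ac (ac-trans p q)   = trans (⟦⟧-ac p) (⟦⟧-ac q)
⟦⟧-ac (ac-I p)         = cong ω^⟨_⟩ (⟦⟧-ac p)
⟦⟧-ac (ac-E p)         = cong (_⊕ 𝟏) (⟦⟧-ac p)
⟦⟧-ac (ac-s p)         = cong (_⊕ 𝟏) (⟦⟧-ac p)
⟦⟧-ac (ac-A _ q)       = cong ⟦A⟧ (⟦⟧-ac q)
⟦⟧-ac (ac-B _ q)       = cong (2 ·_) (⟦⟧-ac q)
⟦⟧-ac (ac-C p q)       = cong₂ ⟦C⟧ (numeral-ac p) (⟦⟧-ac q)
⟦⟧-ac (ac-D _ q)       = ⟦⟧-ac q
⟦⟧-ac (ac-∣ p q)       = cong₂ _⊕_ (⟦⟧-ac p) (⟦⟧-ac q)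

size-ac : t ≈AC u → size t ≡ size u
size-ac (ac-assoc t u v) = cong suc (trans (cong suc (ℕ.+-assoc (size t) (size u) (size v)))
                                           (sym (ℕ.+-suc (size t) (size u + size v))))
size-ac (ac-comm t u)    = cong suc (ℕ.+-comm (size t) (size u))
size-ac ac-refl          = refl
size-ac (ac-sym p)       = sym (size-ac p)
size-ac (ac-trans p q)   = trans (size-ac p) (size-ac q)
size-ac (ac-I p)         = cong suc (size-ac p)
size-ac (ac-E p)         = cong suc (size-ac p)
size-ac (ac-s p)         = cong suc (size-ac p)
size-ac (ac-A p q)       = cong₂ (λ m n → suc (m + n)) (size-ac p) (size-ac q)
size-ac (ac-B p q)       = cong₂ (λ m n → suc (m + n)) (size-ac p) (size-ac q)
size-ac (ac-C p q)       = cong₂ (λ m n → suc (m + n)) (size-ac p) (size-ac q)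
size-ac (ac-D p q)       = cong₂ (λ m n → suc (m + n)) (size-ac p) (size-ac q)
size-ac (ac-∣ p q)       = cong₂ (λ m n → suc (m + n)) (size-ac p) (size-ac q)

dArgSize-ac : t ≈AC u → dArgSize t ≡ dArgSize u
dArgSize-ac (ac-assoc t u v) = ℕ.+-assoc (dArgSize t) (dArgSize u) (dArgSize v)
dArgSize-ac (ac-comm t u)    = ℕ.+-comm (dArgSize t) (dArgSize u)
dArgSize-ac ac-refl          = refl
dArgSize-ac (ac-sym p)       = sym (dArgSize-ac p)
dArgSize-ac (ac-trans p q)   = trans (dArgSize-ac p) (dArgSize-ac q)
dArgSize-ac (ac-I p)         = dArgSize-ac p
dArgSize-ac (ac-E p)         = dArgSize-ac p
dArgSize-ac (ac-s p)         = dArgSize-ac p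
dArgSize-ac (ac-A _ q)       = dArgSize-ac q
dArgSize-ac (ac-B _ q)       = dArgSize-ac q
dArgSize-ac (ac-C _ q)       = dArgSize-ac q
dArgSize-ac (ac-D _ q)       = cong₂ _+_ (size-ac q) (dArgSize-ac q)
dArgSize-ac (ac-∣ p q)       = cong₂ _+_ (dArgSize-ac p) (dArgSize-ac q)

counters-ac : t ≈AC u → counters t ≈AC counters u
counters-ac (ac-assoc t u v) = ac-assoc (counters t) (counters u) (counters v)
counters-ac (ac-comm t u)    = ac-comm (counters t) (counters u)
counters-ac ac-refl          = ac-refl
counters-ac (ac-sym p)       = ac-sym (counters-ac p)
counters-ac (ac-trans p q)   = ac-trans (counters-ac p) (counters-ac q)
counters-ac (ac-I p)         = counters-ac p
counters-ac (ac-E p)         = counters-ac p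
counters-ac (ac-s p)         = counters-ac p
counters-ac (ac-A p q)       = ac-∣ p (counters-ac q)
counters-ac (ac-B p q)       = ac-∣ p (counters-ac q)
counters-ac (ac-C p q)       = ac-∣ p (counters-ac q)
counters-ac (ac-D p q)       = ac-∣ p (counters-ac q)
counters-ac (ac-∣ p q)       = ac-∣ (counters-ac p) (counters-ac q)

counterDepth-ac : t ≈AC u → counterDepth t ≡ counterDepth u
counterDepth-ac (ac-assoc t u v) = ℕ.⊔-assoc (counterDepth t) (counterDepth u) (counterDepth v)
counterDepth-ac (ac-comm t u)    = ℕ.⊔-comm (counterDepth t) (counterDepth u)
counterDepth-ac ac-refl          = refl
counterDepth-ac (ac-sym p)       = sym (counterDepth-ac p)
counterDepth-ac (ac-trans p q)   = trans (counterDepth-ac p) (counterDepth-ac q)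
counterDepth-ac (ac-I p)         = counterDepth-ac p
counterDepth-ac (ac-E p)         = counterDepth-ac p
counterDepth-ac (ac-s p)         = counterDepth-ac p
counterDepth-ac (ac-A p q)       = cong₂ (λ m n → suc m ⊔ n) (counterDepth-ac p) (counterDepth-ac q)
counterDepth-ac (ac-B p q)       = cong₂ (λ m n → suc m ⊔ n) (counterDepth-ac p) (counterDepth-ac q)
counterDepth-ac (ac-C p q)       = cong₂ (λ m n → suc m ⊔ n) (counterDepth-ac p) (counterDepth-ac q)
counterDepth-ac (ac-D p q)       = cong₂ (λ m n → suc m ⊔ n) (counterDepth-ac p) (counterDepth-ac q)
counterDepth-ac (ac-∣ p q)       = cong₂ _⊔_ (counterDepth-ac p) (counterDepth-ac q)

numeral-step : H ⊢ t ⟶ t' → numeral t' ≡ numeral t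
numeral-step (root r1 _)  = refl
numeral-step (root r2 _)  = refl
numeral-step (root r3 _)  = refl
numeral-step (root r4 _)  = refl
numeral-step (root r5 _)  = refl
numeral-step (root r6 _)  = refl
numeral-step (root r7 _)  = refl
numeral-step (root r8 _)  = refl
numeral-step (root r9 _)  = refl
numeral-step (root r10 _) = refl
numeral-step (root r11 _) = refl
numeral-step (root r12 _) = refl
numeral-step (root r13 _) = refl
numeral-step (root r14 _) = refl
numeral-step (ctx-s p)    = cong suc (numeral-step p)
numeral-step (ctx-I _)    = refl
numeral-step (ctx-E _)    = refl
numeral-step (ctx-A₁ _)   = refl
numeral-step (ctx-A₂ _)   = refl
numeral-step (ctx-B₁ _)   = refl
numeral-step (ctx-B₂ _)   = refl
numeral-step (ctx-C₁ _)   = refl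
numeral-step (ctx-C₂ _)   = refl
numeral-step (ctx-D₁ _)   = refl
numeral-step (ctx-D₂ _)   = refl
numeral-step (ctx-∣₁ _)   = refl
numeral-step (ctx-∣₂ _)   = refl

counterDepth-step : H ⊢ t ⟶ t' → counterDepth t' ℕ.≤ counterDepth t
counterDepth-step (root r1 _)  = ℕ.≤-refl
counterDepth-step (root r2 _)  = ℕ.≤-refl
counterDepth-step (root r3 σ)  = ℕ.⊔-lub (ℕ.m≤m⊔n (suc (counterDepth (σ 0))) (counterDepth (σ 1))) ℕ.≤-refl
counterDepth-step (root r4 σ)  = ℕ.m≤n⊔m 1 (counterDepth (σ 1))
counterDepth-step (root r5 σ)  = ℕ.⊔-lub (ℕ.m≤n⊔m (suc (counterDepth (σ 0))) (counterDepth (σ 1))) ℕ.≤-refl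
counterDepth-step (root r6 _)  = ℕ.≤-refl
counterDepth-step (root r7 _)  = ℕ.≤-refl
counterDepth-step (root r8 _)  = ℕ.≤-refl
counterDepth-step (root r9 σ)  =
  ℕ.≤-reflexive (ℕ.⊔-assoc (suc (counterDepth (σ 0))) (counterDepth (σ 1)) (counterDepth (σ 2)))
counterDepth-step (root r10 σ) =
  ℕ.≤-reflexive (ℕ.⊔-assoc (suc (counterDepth (σ 0))) (counterDepth (σ 1)) (counterDepth (σ 2)))
counterDepth-step (root r11 _) = ℕ.≤-refl
counterDepth-step (root r12 _) = ℕ.≤-refl
counterDepth-step (root r13 _) = ℕ.≤-refl
counterDepth-step (root r14 _) = ℕ.≤-refl
counterDepth-step (ctx-I p)    = counterDepth-step p
counterDepth-step (ctx-E p)    = counterDepth-step p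
counterDepth-step (ctx-s p)    = counterDepth-step p
counterDepth-step (ctx-A₁ {u = t} p) = ℕ.⊔-monoˡ-≤ (counterDepth t) (s≤s (counterDepth-step p))
counterDepth-step (ctx-A₂ {t = m} p) = ℕ.⊔-monoʳ-≤ (suc (counterDepth m)) (counterDepth-step p)
counterDepth-step (ctx-B₁ {u = t} p) = ℕ.⊔-monoˡ-≤ (counterDepth t) (s≤s (counterDepth-step p))
counterDepth-step (ctx-B₂ {t = m} p) = ℕ.⊔-monoʳ-≤ (suc (counterDepth m)) (counterDepth-step p)
counterDepth-step (ctx-C₁ {u = t} p) = ℕ.⊔-monoˡ-≤ (counterDepth t) (s≤s (counterDepth-step p))
counterDepth-step (ctx-C₂ {t = m} p) = ℕ.⊔-monoʳ-≤ (suc (counterDepth m)) (counterDepth-step p)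
counterDepth-step (ctx-D₁ {u = t} p) = ℕ.⊔-monoˡ-≤ (counterDepth t) (s≤s (counterDepth-step p))
counterDepth-step (ctx-D₂ {t = m} p) = ℕ.⊔-monoʳ-≤ (suc (counterDepth m)) (counterDepth-step p)
counterDepth-step (ctx-∣₁ {u = u} p) = ℕ.⊔-monoˡ-≤ (counterDepth u) (counterDepth-step p)
counterDepth-step (ctx-∣₂ {t = t} p) = ℕ.⊔-monoʳ-≤ (counterDepth t) (counterDepth-step p)

data Descent (t t' : Term) : Set where
  ⟦⟧-decreases       : ⟦ t' ⟧ < ⟦ t ⟧ → Descent t t'
  counters-step      : ⟦ t' ⟧ ≡ ⟦ t ⟧ → H ⊢ counters t ⟶ counters t' → Descent t t'
  -- Preserving size keeps dArgSize decreasing below a surrounding D.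
  dArgSize-decreases : ⟦ t' ⟧ ≡ ⟦ t ⟧ → counters t' ≈AC counters t →
                       dArgSize t' ℕ.< dArgSize t → size t' ≡ size t → Descent t t'

root-descent : ∀ {l r} → H l r → (σ : Subst) → Descent (l [ σ ]) (r [ σ ])
root-descent r1 σ = ⟦⟧-decreases (⟦A⟧-monoʳ-< 𝟏-NF (ω^⟨⟩-NF 𝟏-NF) (<-exp 𝟎<ω^))
root-descent r2 σ =
  ⟦⟧-decreases (⟦A⟧-monoʳ-< (ω^⟨⟩-NF nX) (ω^⟨⟩-NF (⊕-NF 𝟏 X 𝟏-NF nX)) (<-exp (<𝟏⊕ X nX)))
  where X = ⟦ σ 1 ⟧; nX = ⟦⟧-NF (σ 1)
root-descent r3 σ = ⟦⟧-decreases (<⊕𝟏 _ (·-NF 2 (ω^⟨⟩-NF (⟦⟧-NF (σ 1)))))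
root-descent r4 σ = ⟦⟧-decreases (⊕-monoʳ-< ⟦ σ 1 ⟧ (⟦⟧-NF (σ 1)) 𝟏-NF (·-NF 2 𝟏-NF) (<-tail 𝟎<ω^))
root-descent r5 σ = ⟦⟧-decreases (⊕⟦C⟧<⟦C⟧-suc (numeral (σ 0)) (⟦⟧-NF (σ 1)))
root-descent r6 σ =
  ⟦⟧-decreases (ω^⟨⟩⊕𝟏-< (⊕-monoˡ-< ⟦ σ 2 ⟧ (⟦⟧-NF (σ 2)) nX (⊕-NF X 𝟏 nX 𝟏-NF) (<⊕𝟏 X nX)))
  where X = ⟦ σ 1 ⟧; nX = ⟦⟧-NF (σ 1)
root-descent r7 σ = ⟦⟧-decreases (ω^⟨⟩⊕𝟏-< (<⊕𝟏 ⟦ σ 1 ⟧ (⟦⟧-NF (σ 1))))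
root-descent r8 σ =
  dArgSize-decreases refl ac-refl ℕ.≤-refl (cong suc (sym (ℕ.+-suc (size (σ 0)) (suc (size (σ 1))))))
root-descent r9 σ = dArgSize-decreases refl (ac-assoc (σ 0) (counters (σ 1)) (counters (σ 2)))
  (subst (suc (suc sx + dx + dy) ℕ.≤_) (dArgSize-shift sx sy dx dy)
         (ℕ.m≤m+n (suc (suc sx + dx + dy)) (suc sy)))
  (size-shift (size (σ 0)) sx sy)
  where
  sx = size (σ 1); sy = size (σ 2); dx = dArgSize (σ 1); dy = dArgSize (σ 2)
  dArgSize-shift : ∀ sx sy dx dy → suc (suc sx + dx + dy) + suc sy ≡ suc (suc (suc sx + sy)) + (dx + dy)
  dArgSize-shift = solve-∀
  size-shift : ∀ sn sx sy → suc (suc (suc (sn + suc sx) + sy)) ≡ suc (sn + suc (suc (suc sx + sy)))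
  size-shift = solve-∀
root-descent r10 σ =
  ⟦⟧-decreases (<-exp (⊕-monoˡ-< ⟦ σ 2 ⟧ (⟦⟧-NF (σ 2)) (⟦C⟧-NF k (ω^⟨⟩-NF nX))
                                 (ω^⟨⟩-NF (⊕-NF 𝟏 X 𝟏-NF nX))
                                 (⟦C⟧-<ω^⟨⟩ k (<-exp (<𝟏⊕ X nX)) (<⇒𝟎< (<𝟏⊕ X nX)))))
  where X = ⟦ σ 1 ⟧; nX = ⟦⟧-NF (σ 1); k = numeral (σ 0)
root-descent r11 σ =
  ⟦⟧-decreases (<-exp (⟦C⟧-<ω^⟨⟩ (numeral (σ 0)) (<-exp (<𝟏⊕ X nX)) (<⇒𝟎< (<𝟏⊕ X nX))))
  where X = ⟦ σ 1 ⟧; nX = ⟦⟧-NF (σ 1)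
root-descent r12 σ =
  ⟦⟧-decreases (<-exp (⊕-monoˡ-< ⟦ σ 2 ⟧ (⟦⟧-NF (σ 2)) (⟦C⟧-NF k 𝟏-NF) (ω^⟨⟩-NF 𝟏-NF)
                                 (⟦C⟧-<ω^⟨⟩ k (<-exp 𝟎<ω^) 𝟎<ω^)))
  where k = numeral (σ 0)
root-descent r13 σ = ⟦⟧-decreases (<-exp (⟦C⟧-<ω^⟨⟩ (numeral (σ 0)) (<-exp 𝟎<ω^) 𝟎<ω^))
root-descent r14 σ = ⟦⟧-decreases (⟦A⟧<2·[⊕𝟏] ⟦ σ 1 ⟧ (⟦⟧-NF (σ 1)))

descent : H ⊢ t ⟶ t' → Descent t t'
descent (root r σ) = root-descent r σ
descent (ctx-I p) with descent p
... | ⟦⟧-decreases q              = ⟦⟧-decreases (<-exp q)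
... | counters-step e q          = counters-step (cong ω^⟨_⟩ e) q
... | dArgSize-decreases e ac lt sz = dArgSize-decreases (cong ω^⟨_⟩ e) ac lt (cong suc sz)
descent (ctx-E {t} {t'} p) with descent p
... | ⟦⟧-decreases q              = ⟦⟧-decreases (⊕-monoˡ-< 𝟏 𝟏-NF (⟦⟧-NF t') (⟦⟧-NF t) q)
... | counters-step e q          = counters-step (cong (_⊕ 𝟏) e) q
... | dArgSize-decreases e ac lt sz = dArgSize-decreases (cong (_⊕ 𝟏) e) ac lt (cong suc sz)
descent (ctx-s {t} {t'} p) with descent p
... | ⟦⟧-decreases q              = ⟦⟧-decreases (⊕-monoˡ-< 𝟏 𝟏-NF (⟦⟧-NF t') (⟦⟧-NF t) q)
... | counters-step e q          = counters-step (cong (_⊕ 𝟏) e) q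
... | dArgSize-decreases e ac lt sz = dArgSize-decreases (cong (_⊕ 𝟏) e) ac lt (cong suc sz)
descent (ctx-A₁ p) = counters-step refl (ctx-∣₁ p)
descent (ctx-A₂ {m} {u} {u'} p) with descent p
... | ⟦⟧-decreases q              = ⟦⟧-decreases (⟦A⟧-monoʳ-< (⟦⟧-NF u') (⟦⟧-NF u) q)
... | counters-step e q          = counters-step (cong ⟦A⟧ e) (ctx-∣₂ q)
... | dArgSize-decreases e ac lt sz =
      dArgSize-decreases (cong ⟦A⟧ e) (ac-∣ ac-refl ac) lt (cong (λ w → suc (size m + w)) sz)
descent (ctx-B₁ p) = counters-step refl (ctx-∣₁ p)
descent (ctx-B₂ {m} {u} {u'} p) with descent p
... | ⟦⟧-decreases q              = ⟦⟧-decreases (·-monoʳ-< 1 (⟦⟧-NF u') (⟦⟧-NF u) q)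
... | counters-step e q          = counters-step (cong (2 ·_) e) (ctx-∣₂ q)
... | dArgSize-decreases e ac lt sz =
      dArgSize-decreases (cong (2 ·_) e) (ac-∣ ac-refl ac) lt (cong (λ w → suc (size m + w)) sz)
descent (ctx-C₁ {u = u} p) = counters-step (cong (λ k → ⟦C⟧ k ⟦ u ⟧) (numeral-step p)) (ctx-∣₁ p)
descent (ctx-C₂ {m} {u} {u'} p) with descent p
... | ⟦⟧-decreases q              = ⟦⟧-decreases (⟦C⟧-monoʳ-< (numeral m) (⟦⟧-NF u') (⟦⟧-NF u) q)
... | counters-step e q          = counters-step (cong (⟦C⟧ (numeral m)) e) (ctx-∣₂ q)
... | dArgSize-decreases e ac lt sz =
      dArgSize-decreases (cong (⟦C⟧ (numeral m)) e) (ac-∣ ac-refl ac) lt (cong (λ w → suc (size m + w)) sz)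
descent (ctx-D₁ p) = counters-step refl (ctx-∣₁ p)
descent (ctx-D₂ {m} p) with descent p
... | ⟦⟧-decreases q              = ⟦⟧-decreases q
... | counters-step e q          = counters-step e (ctx-∣₂ q)
... | dArgSize-decreases e ac lt sz =
      dArgSize-decreases e (ac-∣ ac-refl ac) (ℕ.+-mono-≤-< (ℕ.≤-reflexive sz) lt)
                         (cong (λ w → suc (size m + w)) sz)
descent (ctx-∣₁ {t} {t'} {u} p) with descent p
... | ⟦⟧-decreases q              = ⟦⟧-decreases (⊕-monoˡ-< ⟦ u ⟧ (⟦⟧-NF u) (⟦⟧-NF t') (⟦⟧-NF t) q)
... | counters-step e q          = counters-step (cong (_⊕ ⟦ u ⟧) e) (ctx-∣₁ q)
... | dArgSize-decreases e ac lt sz =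
      dArgSize-decreases (cong (_⊕ ⟦ u ⟧) e) (ac-∣ ac ac-refl) (ℕ.+-monoˡ-< (dArgSize u) lt)
                         (cong (λ w → suc (w + size u)) sz)
descent (ctx-∣₂ {t} {u} {u'} p) with descent p
... | ⟦⟧-decreases q              = ⟦⟧-decreases (⊕-monoʳ-< ⟦ t ⟧ (⟦⟧-NF t) (⟦⟧-NF u') (⟦⟧-NF u) q)
... | counters-step e q          = counters-step (cong (⟦ t ⟧ ⊕_) e) (ctx-∣₂ q)
... | dArgSize-decreases e ac lt sz =
      dArgSize-decreases (cong (⟦ t ⟧ ⊕_) e) (ac-∣ ac-refl ac) (ℕ.+-monoʳ-< (dArgSize t) lt)
                         (cong (λ w → suc (size t + w)) sz)

⟵AC-respʳ-≈AC : _⟵AC_ Respectsʳ _≈AC_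
⟵AC-respʳ-≈AC u≈u' (u₁ , t₁ , u≈u₁ , step , t₁≈t) =
  u₁ , t₁ , ac-trans (ac-sym u≈u') u≈u₁ , step , t₁≈t

counterDepth-⟵AC : t' ⟵AC t → counterDepth t' ℕ.≤ counterDepth t
counterDepth-⟵AC (_ , _ , t≈t₁ , step , t₁'≈t') =
  subst₂ ℕ._≤_ (counterDepth-ac t₁'≈t') (sym (counterDepth-ac t≈t₁)) (counterDepth-step step)

Measure : Set
Measure = Ord × Term × ℕ

measure : Term → Measure
measure t = ⟦ t ⟧ , counters t , dArgSize t

-- Restricted to accessible collections, the step relation is well founded outright.
_⊲_ : Term → Term → Set
_⊲_ = _⟵AC_ restrictedTo Acc _⟵AC_

⊲-respʳ-≈AC : _⊲_ Respectsʳ _≈AC_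
⊲-respʳ-≈AC u≈u' (acc-u , t⟵u) =
  Acc-resp-≈ ac-sym ⟵AC-respʳ-≈AC u≈u' acc-u , ⟵AC-respʳ-≈AC u≈u' t⟵u

_⊏_ : Measure → Measure → Set
_⊏_ = ×-Lex _≡_ _≺_ (×-Lex _≈AC_ _⊲_ ℕ._<_)

⊏-wellFounded : WellFounded _⊏_
⊏-wellFounded = ×-wellFounded ≺-wellFounded
                  (×-wellFounded' ac-trans ⊲-respʳ-≈AC restrictedTo-Acc-wellFounded <-wellFounded)

measure-decreases : Acc _⟵AC_ (counters t) → t' ⟵AC t → measure t' ⊏ measure t
measure-decreases {t} {t'} acc-counters (t₁ , t₁' , t≈t₁ , step , t₁'≈t') = from-descent (descent step)
  where
  ⟦⟧-≡ : ⟦ t₁' ⟧ ≡ ⟦ t₁ ⟧ → ⟦ t' ⟧ ≡ ⟦ t ⟧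
  ⟦⟧-≡ e = trans (sym (⟦⟧-ac t₁'≈t')) (trans e (sym (⟦⟧-ac t≈t₁)))

  from-descent : Descent t₁ t₁' → measure t' ⊏ measure t
  from-descent (⟦⟧-decreases q) =
    inj₁ (⟦⟧-NF t' , subst₂ _<_ (⟦⟧-ac t₁'≈t') (sym (⟦⟧-ac t≈t₁)) q)
  from-descent (counters-step e q) =
    inj₂ (⟦⟧-≡ e , inj₁ (acc-counters ,
                        (counters t₁ , counters t₁' , counters-ac t≈t₁ , q , counters-ac t₁'≈t')))
  from-descent (dArgSize-decreases e c d _) =
    inj₂ (⟦⟧-≡ e , inj₂ (ac-trans (ac-sym (counters-ac t₁'≈t')) (ac-trans c (ac-sym (counters-ac t≈t₁))) ,
                         subst₂ ℕ._<_ (dArgSize-ac t₁'≈t') (sym (dArgSize-ac t≈t₁)) d))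

counters-acc⇒acc : ∀ k → (∀ u → counterDepth u ℕ.≤ k → Acc _⟵AC_ (counters u)) →
                   ∀ t → counterDepth t ℕ.≤ k → Acc _⟵AC_ t
counters-acc⇒acc k counters-acc t bound =
  acc-restrictedTo⇒acc (λ b t'⟵t → ℕ.≤-trans (counterDepth-⟵AC t'⟵t) b) bound
    (Subrelation.accessible (λ {_} {u} (b , t'⟵u) → measure-decreases (counters-acc u b) t'⟵u)
      (On.accessible measure (⊏-wellFounded (measure t))))

data Flat : Term → Set where
  h   : Flat h
  _∣_ : Flat t → Flat u → Flat (t ∣ u)

Flat-≈AC : t ≈AC u → (Flat t → Flat u) × (Flat u → Flat t)
Flat-≈AC (ac-assoc _ _ _) = (λ { ((f ∣ g) ∣ k) → f ∣ (g ∣ k) }) , (λ { (f ∣ (g ∣ k)) → (f ∣ g) ∣ k })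
Flat-≈AC (ac-comm _ _)    = (λ { (f ∣ g) → g ∣ f }) , (λ { (f ∣ g) → g ∣ f })
Flat-≈AC ac-refl          = (λ f → f) , (λ f → f)
Flat-≈AC (ac-sym p)       = proj₂ (Flat-≈AC p) , proj₁ (Flat-≈AC p)
Flat-≈AC (ac-trans p q)   = (λ f → proj₁ (Flat-≈AC q) (proj₁ (Flat-≈AC p) f)) ,
                            (λ f → proj₂ (Flat-≈AC p) (proj₂ (Flat-≈AC q) f))
Flat-≈AC (ac-I _)         = (λ ()) , (λ ())
Flat-≈AC (ac-E _)         = (λ ()) , (λ ())
Flat-≈AC (ac-s _)         = (λ ()) , (λ ())
Flat-≈AC (ac-A _ _)       = (λ ()) , (λ ())
Flat-≈AC (ac-B _ _)       = (λ ()) , (λ ())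
Flat-≈AC (ac-C _ _)       = (λ ()) , (λ ())
Flat-≈AC (ac-D _ _)       = (λ ()) , (λ ())
Flat-≈AC (ac-∣ p q)       = (λ { (f ∣ g) → proj₁ (Flat-≈AC p) f ∣ proj₁ (Flat-≈AC q) g }) ,
                            (λ { (f ∣ g) → proj₂ (Flat-≈AC p) f ∣ proj₂ (Flat-≈AC q) g })

Flat-irreducible : Flat t → ¬ H ⊢ t ⟶ u
Flat-irreducible () (root r1 _)
Flat-irreducible () (root r2 _)
Flat-irreducible () (root r3 _)
Flat-irreducible () (root r4 _)
Flat-irreducible () (root r5 _)
Flat-irreducible () (root r6 _)
Flat-irreducible () (root r7 _)
Flat-irreducible () (root r8 _)
Flat-irreducible () (root r9 _)
Flat-irreducible () (root r10 _)
Flat-irreducible () (root r11 _)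
Flat-irreducible () (root r12 _)
Flat-irreducible () (root r13 _)
Flat-irreducible () (root r14 _)
Flat-irreducible (f ∣ _) (ctx-∣₁ p) = Flat-irreducible f p
Flat-irreducible (_ ∣ g) (ctx-∣₂ p) = Flat-irreducible g p

Flat-acc : Flat t → Acc _⟵AC_ t
Flat-acc f = acc λ (_ , _ , t≈t₁ , step , _) → ⊥-elim (Flat-irreducible (proj₁ (Flat-≈AC t≈t₁) f) step)

counters-Flat : ∀ u → counterDepth u ℕ.≤ 0 → Flat (counters u)
counters-Flat (var _) _ = h
counters-Flat h       _ = h
counters-Flat 𝟘       _ = h
counters-Flat (I t)   b = counters-Flat t b
counters-Flat (E t)   b = counters-Flat t b
counters-Flat (s t)   b = counters-Flat t b
counters-Flat (A m t) b = ⊥-elim (ℕ.n≮0 (ℕ.m⊔n≤o⇒m≤o (suc (counterDepth m)) (counterDepth t) b))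
counters-Flat (B m t) b = ⊥-elim (ℕ.n≮0 (ℕ.m⊔n≤o⇒m≤o (suc (counterDepth m)) (counterDepth t) b))
counters-Flat (C m t) b = ⊥-elim (ℕ.n≮0 (ℕ.m⊔n≤o⇒m≤o (suc (counterDepth m)) (counterDepth t) b))
counters-Flat (D m t) b = ⊥-elim (ℕ.n≮0 (ℕ.m⊔n≤o⇒m≤o (suc (counterDepth m)) (counterDepth t) b))
counters-Flat (t ∣ u) b = counters-Flat t (ℕ.m⊔n≤o⇒m≤o (counterDepth t) (counterDepth u) b)
                        ∣ counters-Flat u (ℕ.m⊔n≤o⇒n≤o (counterDepth t) (counterDepth u) b)

mutual
  counterDepth-counters : ∀ k u → counterDepth u ℕ.≤ suc k → counterDepth (counters u) ℕ.≤ k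
  counterDepth-counters k (var _) _ = z≤n
  counterDepth-counters k h       _ = z≤n
  counterDepth-counters k 𝟘       _ = z≤n
  counterDepth-counters k (I t)   b = counterDepth-counters k t b
  counterDepth-counters k (E t)   b = counterDepth-counters k t b
  counterDepth-counters k (s t)   b = counterDepth-counters k t b
  counterDepth-counters k (A m t) b = counterDepth-counters-node k m t b
  counterDepth-counters k (B m t) b = counterDepth-counters-node k m t b
  counterDepth-counters k (C m t) b = counterDepth-counters-node k m t b
  counterDepth-counters k (D m t) b = counterDepth-counters-node k m t b
  counterDepth-counters k (t ∣ u) b =
    ℕ.⊔-lub (counterDepth-counters k t (ℕ.m⊔n≤o⇒m≤o (counterDepth t) (counterDepth u) b))
            (counterDepth-counters k u (ℕ.m⊔n≤o⇒n≤o (counterDepth t) (counterDepth u) b))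

  counterDepth-counters-node : ∀ k m t → suc (counterDepth m) ⊔ counterDepth t ℕ.≤ suc k →
                               counterDepth (m ∣ counters t) ℕ.≤ k
  counterDepth-counters-node k m t b =
    ℕ.⊔-lub (ℕ.≤-pred (ℕ.m⊔n≤o⇒m≤o (suc (counterDepth m)) (counterDepth t) b))
            (counterDepth-counters k t (ℕ.m⊔n≤o⇒n≤o (suc (counterDepth m)) (counterDepth t) b))

counters-accessible : ∀ k u → counterDepth u ℕ.≤ k → Acc _⟵AC_ (counters u)
counters-accessible zero    u b = Flat-acc (counters-Flat u b)
counters-accessible (suc k) u b =
  counters-acc⇒acc k (counters-accessible k) (counters u) (counterDepth-counters k u b)

mainTheorem1 : WellFounded (λ u t → H ⊢ t ⟶AC u)
mainTheorem1 t = counters-acc⇒acc (counterDepth t) (counters-accessible (counterDepth t)) t ℕ.≤-refl
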